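{- Let $u_0,r\ge 1$ be integers with $\gcd(u_0,r)=1$, let $u_k:=u_0+kr$ for $k\ge 0$, and let $L_n:=\operatorname{lcm}\{u_0,u_1,\ldots,u_n\}$. Let $a\ge 2$ be any given integer. Then for any integers $\alpha, r\ge a$ and $n\ge 2\alpha r$, we have $L_n\ge u_0\, r^{\alpha+a-2}(r+1)^n$.
   Context: Arithmetic progression $u_k=u_0+kr$ with $\gcd(u_0,r)=1$; $L_n$ is the least common multiple of $u_0,\ldots,u_n$. -}

module Defs where

open import Data.Nat using (ℕ; zero; suc; _+_; _*_)
open import Data.Nat.LCM using (lcm)

u : ℕ → ℕ → ℕ → ℕ
u u₀ r k = u₀ + k * r

L : ℕ → ℕ → ℕ → ℕ
L u₀ r zero    = u u₀ r zero
L u₀ r (suc n) = lcm (L u₀ r n) (u u₀ r (suc n))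

-- Split n = k + m with k a mode of (r + 1) ^ n = Σ C(n, j) r ^ (n - j), so that
-- (r + 1) ^ n ≤ (n + 1) C(n, k) r ^ m.  The m + 1 consecutive terms u_k ⋯ u_n divide m! r^m L_n,
-- and being coprime to r they divide (m! / r^D) L_n whenever r^D ∣ m!.  Compared with
-- (k + 1) r ⋯ (k + m) r = m! C(n, k) r^m, the product u_k ⋯ u_n is larger by a factor
-- u₀ (m + 2km) / n: expand ∏ (1 + u₀ / ((k + j) r)) to second order and apply AM-GM.
-- Hence u₀ r^e (r + 1)^n ≤ L_n as soon as r^(e+d) ∣ m! and n (n + 1) ≤ r^d (m + 2km).
-- For n ≥ 2αr the latter holds with d = 1 (d = 2 if r = 2), and counting the multiples
-- of r and of r² up to m supplies the power of r dividing m!.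

module Submission where

open import Defs
open import Data.Nat using (ℕ; _+_; _*_; _∸_; _^_; _≤_; _≥_)
open import Data.Nat.GCD using (gcd)
open import Relation.Binary.PropositionalEquality using (_≡_)

open import Data.Nat.Base
open import Data.Nat.Properties
open import Data.Nat.Divisibility
open import Data.Nat.Coprimality using (Coprime; coprime-+; coprime-divisor; 1-coprimeTo; gcd≡1⇒coprime)
open import Data.Nat.LCM using (lcm; m∣lcm[m,n]; n∣lcm[m,n]; gcd*lcm)
open import Data.Nat.Tactic.RingSolver using (solve-∀)
open import Data.Product.Base using (_×_; _,_; ∃₂)
open import Data.Sum.Base using (inj₁; inj₂; [_,_]′)
open import Data.Unit.Base using (tt)
open import Relation.Nullary.Decidable using (yes; no)
open import Relation.Nullary.Negation using (contradiction)
open import Relation.Binary.PropositionalEquality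
open import Algebra.Properties.CommutativeSemigroup *-commutativeSemigroup using (x∙yz≈y∙xz; x∙yz≈y∙zx; x∙yz≈yx∙z; xy∙z≈y∙xz)

sumBelow : ℕ → (ℕ → ℕ) → ℕ
sumBelow zero    f = 0
sumBelow (suc K) f = sumBelow K f + f K

sumBelow-≤ : ∀ {c} (f : ℕ → ℕ) → (∀ k → f k ≤ c) → ∀ K → sumBelow K f ≤ K * c
sumBelow-≤ f f≤c zero    = z≤n
sumBelow-≤ {c} f f≤c (suc K) =
  subst (sumBelow K f + f K ≤_) (+-comm (K * c) c) (+-mono-≤ (sumBelow-≤ f f≤c K) (f≤c K))

unimodal-≤-peak : ∀ (f : ℕ → ℕ) q →
  (∀ k → k < q → f k ≤ f (suc k)) → (∀ k → q ≤ k → f (suc k) ≤ f k) →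
  ∀ k → f k ≤ f q
unimodal-≤-peak f q ascending descending k with ≤-total k q
... | inj₁ k≤q = climb (≤⇒≤′ k≤q) ≤-refl
  where
  climb : ∀ {j} → k ≤′ j → j ≤ q → f k ≤ f j
  climb ≤′-refl        _   = ≤-refl
  climb (≤′-step k≤′j) j<q = ≤-trans (climb k≤′j (<⇒≤ j<q)) (ascending _ j<q)
... | inj₂ q≤k = descend (≤⇒≤′ q≤k)
  where
  descend : ∀ {j} → q ≤′ j → f j ≤ f q
  descend ≤′-refl        = ≤-refl
  descend (≤′-step q≤′j) = ≤-trans (descending _ (≤′⇒≤ q≤′j)) (descend q≤′j)

-- binomialTerm r n k = C(n, k) · r ^ (n - k), generated by Pascal's rule.
binomialTerm : ℕ → ℕ → ℕ → ℕ
binomialTerm r zero    zero    = 1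
binomialTerm r zero    (suc k) = 0
binomialTerm r (suc n) zero    = r * binomialTerm r n zero
binomialTerm r (suc n) (suc k) = binomialTerm r n k + r * binomialTerm r n (suc k)

binomialTerm-≡0 : ∀ r {n k} → n < k → binomialTerm r n k ≡ 0
binomialTerm-≡0 r {zero}  {suc k} _         = refl
binomialTerm-≡0 r {suc n} {suc k} (s≤s n<k)
  rewrite binomialTerm-≡0 r n<k | binomialTerm-≡0 r (m<n⇒m<1+n n<k) = *-zeroʳ r

binomialTerm-diag : ∀ r n → binomialTerm r n n ≡ 1
binomialTerm-diag r zero = refl
binomialTerm-diag r (suc n)
  rewrite binomialTerm-diag r n | binomialTerm-≡0 r (n<1+n n) | *-zeroʳ r = refl

binomialTerm-ratio : ∀ r n k →
  binomialTerm r n (suc k) * (suc k * r) ≡ binomialTerm r n k * (n ∸ k)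
binomialTerm-ratio r zero    k rewrite 0∸n≡0 k = sym (*-zeroʳ (binomialTerm r 0 k))
binomialTerm-ratio r (suc n) zero = begin
  (a + r * b) * (1 * r)       ≡⟨ expand a b r ⟩
  a * r + r * (b * (1 * r))   ≡⟨ cong (λ x → a * r + r * x) (binomialTerm-ratio r n zero) ⟩
  a * r + r * (a * n)         ≡⟨ collect a r n ⟩
  r * a * suc n               ∎
  where
  open ≡-Reasoning
  a = binomialTerm r n 0
  b = binomialTerm r n 1
  expand : ∀ a b r → (a + r * b) * (1 * r) ≡ a * r + r * (b * (1 * r))
  expand = solve-∀
  collect : ∀ a r n → a * r + r * (a * n) ≡ r * a * (1 + n)
  collect = solve-∀
binomialTerm-ratio r (suc n) (suc k) with k <? n
... | no k≮n
  rewrite binomialTerm-≡0 r (s≤s (≮⇒≥ k≮n)) | binomialTerm-≡0 r (s≤s (m≤n⇒m≤1+n (≮⇒≥ k≮n)))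
        | m≤n⇒m∸n≡0 (≮⇒≥ k≮n) | *-zeroʳ r = sym (*-zeroʳ (binomialTerm r n k + 0))
... | yes k<n = begin
  (b + r * c) * (suc (suc k) * r)
    ≡⟨ expand b c r k ⟩
  b * (suc (suc k) * r) + r * (c * (suc (suc k) * r))
    ≡⟨ cong (λ x → b * (suc (suc k) * r) + r * x) (binomialTerm-ratio r n (suc k)) ⟩
  b * (suc (suc k) * r) + r * (b * (n ∸ suc k))
    ≡⟨ shift b r k (n ∸ suc k) ⟩
  b * (suc k * r) + r * b * suc (n ∸ suc k)
    ≡⟨ cong₂ (λ x y → x + r * b * y) (binomialTerm-ratio r n k) (sym (+-∸-assoc 1 k<n)) ⟩
  a * (n ∸ k) + r * b * (n ∸ k)
    ≡⟨ *-distribʳ-+ (n ∸ k) a (r * b) ⟨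
  (a + r * b) * (n ∸ k)
    ∎
  where
  open ≡-Reasoning
  a = binomialTerm r n k
  b = binomialTerm r n (suc k)
  c = binomialTerm r n (suc (suc k))
  expand : ∀ b c r k → (b + r * c) * ((2 + k) * r) ≡ b * ((2 + k) * r) + r * (c * ((2 + k) * r))
  expand = solve-∀
  shift : ∀ b r k d → b * ((2 + k) * r) + r * (b * d) ≡ b * ((1 + k) * r) + r * b * (1 + d)
  shift = solve-∀

sumBelow-pascal : ∀ r n K →
  sumBelow (suc K) (binomialTerm r (suc n)) ≡ r * sumBelow (suc K) (binomialTerm r n) + sumBelow K (binomialTerm r n)
sumBelow-pascal r n zero = sym (+-identityʳ (r * binomialTerm r n 0))
sumBelow-pascal r n (suc K) rewrite sumBelow-pascal r n K =
  regroup (sumBelow K (binomialTerm r n)) (binomialTerm r n K) (binomialTerm r n (suc K)) r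
  where
  regroup : ∀ s a b r → r * (s + a) + s + (a + r * b) ≡ r * (s + a + b) + (s + a)
  regroup = solve-∀

binomial-theorem : ∀ r n → sumBelow (suc n) (binomialTerm r n) ≡ (r + 1) ^ n
binomial-theorem r zero    = refl
binomial-theorem r (suc n) = begin
  sumBelow (suc (suc n)) (binomialTerm r (suc n))
    ≡⟨ sumBelow-pascal r n (suc n) ⟩
  r * (sumBelow (suc n) (binomialTerm r n) + binomialTerm r n (suc n)) + sumBelow (suc n) (binomialTerm r n)
    ≡⟨ cong₂ (λ x y → r * (x + y) + x) (binomial-theorem r n) (binomialTerm-≡0 r (n<1+n n)) ⟩
  r * ((r + 1) ^ n + 0) + (r + 1) ^ n
    ≡⟨ collect r ((r + 1) ^ n) ⟩
  (r + 1) * (r + 1) ^ n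
    ∎
  where
  open ≡-Reasoning
  collect : ∀ r p → r * (p + 0) + p ≡ (r + 1) * p
  collect = solve-∀

module _ (r n k : ℕ) .{{_ : NonZero r}} where

  private instance
    step≢0 : NonZero (suc k * r)
    step≢0 = m*n≢0 (suc k) r

  binomialTerm-ascending : suc k * r ≤ n ∸ k → binomialTerm r n k ≤ binomialTerm r n (suc k)
  binomialTerm-ascending le = *-cancelʳ-≤ _ _ (suc k * r) (begin
    binomialTerm r n k * (suc k * r)       ≤⟨ *-monoʳ-≤ (binomialTerm r n k) le ⟩
    binomialTerm r n k * (n ∸ k)           ≡⟨ binomialTerm-ratio r n k ⟨
    binomialTerm r n (suc k) * (suc k * r) ∎)
    where open ≤-Reasoning

  binomialTerm-descending : n ∸ k ≤ suc k * r → binomialTerm r n (suc k) ≤ binomialTerm r n k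
  binomialTerm-descending le = *-cancelʳ-≤ _ _ (suc k * r) (begin
    binomialTerm r n (suc k) * (suc k * r) ≡⟨ binomialTerm-ratio r n k ⟩
    binomialTerm r n k * (n ∸ k)           ≤⟨ *-monoʳ-≤ (binomialTerm r n k) le ⟩
    binomialTerm r n k * (suc k * r)       ∎)
    where open ≤-Reasoning

-- k r ≤ m + 1 ≤ (k + 1) r makes k a mode of the binomial terms of (r + 1) ^ (k + m).
record Balanced (r k m : ℕ) : Set where
  constructor balanced
  field
    lower : k * r ≤ suc m
    upper : m < suc k * r

balanced-split : ∀ r .{{_ : NonZero r}} n → ∃₂ λ k m → k + m ≡ n × Balanced r k m
balanced-split r zero    = 0 , 0 , refl , balanced z≤n (≤-trans (>-nonZero⁻¹ r) (m≤m+n r 0))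
balanced-split r (suc n) with balanced-split r n
... | k , m , refl , balanced lower upper with suc m <? suc k * r
...   | yes m+1<[k+1]r = k , suc m , +-suc k m , balanced (m≤n⇒m≤1+n lower) m+1<[k+1]r
...   | no  m+1≮[k+1]r =
  suc k , m , refl , balanced (≮⇒≥ m+1≮[k+1]r) (<-≤-trans upper (*-monoˡ-≤ r (n≤1+n (suc k))))

module _ {r k m : ℕ} .{{_ : NonZero r}} (bal : Balanced r k m) where

  open Balanced bal

  binomialTerm-≤-mode : ∀ j → binomialTerm r (k + m) j ≤ binomialTerm r (k + m) k
  binomialTerm-≤-mode = unimodal-≤-peak (binomialTerm r (k + m)) k
    (λ j j<k → binomialTerm-ascending r (k + m) j (begin
      suc j * r     ≤⟨ *-monoˡ-≤ r j<k ⟩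
      k * r         ≤⟨ lower ⟩
      suc m         ≤⟨ m+n≤o⇒m≤o∸n (suc m) (≤-trans (≤-reflexive (cong suc (+-comm m j))) (+-monoˡ-≤ m j<k)) ⟩
      k + m ∸ j     ∎))
    (λ j k≤j → binomialTerm-descending r (k + m) j (begin
      k + m ∸ j     ≤⟨ ∸-monoʳ-≤ (k + m) k≤j ⟩
      k + m ∸ k     ≡⟨ m+n∸m≡n k m ⟩
      m             ≤⟨ <⇒≤ upper ⟩
      suc k * r     ≤⟨ *-monoˡ-≤ r (s≤s k≤j) ⟩
      suc j * r     ∎))
    where open ≤-Reasoning

  binomial-≤-mode : (r + 1) ^ (k + m) ≤ suc (k + m) * binomialTerm r (k + m) k
  binomial-≤-mode = begin
    (r + 1) ^ (k + m)                                 ≡⟨ binomial-theorem r (k + m) ⟨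
    sumBelow (suc (k + m)) (binomialTerm r (k + m))   ≤⟨ sumBelow-≤ _ binomialTerm-≤-mode (suc (k + m)) ⟩
    suc (k + m) * binomialTerm r (k + m) k            ∎
    where open ≤-Reasoning

∏u : ℕ → ℕ → ℕ → ℕ → ℕ
∏u u₀ r k zero    = 1
∏u u₀ r k (suc m) = u u₀ r k * ∏u u₀ r (suc k) m

∏u-snoc : ∀ u₀ r k m → ∏u u₀ r k (suc m) ≡ ∏u u₀ r k m * u u₀ r (k + m)
∏u-snoc u₀ r k zero    rewrite +-identityʳ k = *-comm (u u₀ r k) 1
∏u-snoc u₀ r k (suc m) rewrite ∏u-snoc u₀ r (suc k) m | +-suc k m = sym (*-assoc (u u₀ r k) _ _)

∏u[0]≡m!*binomialTerm : ∀ r k m → ∏u 0 r (suc k) m ≡ m ! * binomialTerm r (k + m) k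
∏u[0]≡m!*binomialTerm r k zero rewrite +-identityʳ k | binomialTerm-diag r k = refl
∏u[0]≡m!*binomialTerm r k (suc m) = begin
  suc k * r * ∏u 0 r (suc (suc k)) m
    ≡⟨ cong (suc k * r *_) (∏u[0]≡m!*binomialTerm r (suc k) m) ⟩
  suc k * r * (m ! * binomialTerm r (suc k + m) (suc k))
    ≡⟨ cong (λ n → suc k * r * (m ! * binomialTerm r n (suc k))) (+-suc k m) ⟨
  suc k * r * (m ! * b)                          ≡⟨ x∙yz≈y∙zx (suc k * r) (m !) b ⟩
  m ! * (b * (suc k * r))                        ≡⟨ cong (m ! *_) (binomialTerm-ratio r (k + suc m) k) ⟩
  m ! * (a * (k + suc m ∸ k))                    ≡⟨ cong (λ d → m ! * (a * d)) (m+n∸m≡n k (suc m)) ⟩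
  m ! * (a * suc m)                              ≡⟨ regroup (m !) a m ⟩
  suc m * m ! * a                                ∎
  where
  open ≡-Reasoning
  a = binomialTerm r (k + suc m) k
  b = binomialTerm r (k + suc m) (suc k)
  regroup : ∀ f a m → f * (a * (1 + m)) ≡ (1 + m) * f * a
  regroup = solve-∀

u∣L : ∀ u₀ r {i n} → i ≤ n → u u₀ r i ∣ L u₀ r n
u∣L u₀ r {n = zero}  z≤n = ∣-refl
u∣L u₀ r {n = suc n} i≤1+n with m≤n⇒m<n∨m≡n i≤1+n
... | inj₁ (s≤s i≤n) = ∣-trans (u∣L u₀ r i≤n) (m∣lcm[m,n] (L u₀ r n) _)
... | inj₂ refl      = n∣lcm[m,n] (L u₀ r n) _

∏u∣m!*r^m*X : ∀ u₀ r k m {X} → (∀ i → i ≤ m → u u₀ r (k + i) ∣ X) →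
  ∏u u₀ r k (suc m) ∣ m ! * r ^ m * X
∏u∣m!*r^m*X u₀ r k zero {X} u∣X =
  subst₂ _∣_ (trans (cong (u u₀ r) (+-identityʳ k)) (sym (*-identityʳ _))) (sym (*-identityˡ X)) (u∣X 0 z≤n)
-- Both shorter windows divide Y; multiplying by their missing end terms, the long window
-- divides B Y and uₖ Y, hence their difference (m + 1) r Y.
∏u∣m!*r^m*X u₀ r k (suc m) {X} u∣X = subst₂ _∣_ (sym long≡) (sym target≡) (∣m+n∣m⇒∣n ∣uₖY+[m+1]rY ∣uₖY)
  where
  uₖ = u u₀ r k
  M  = ∏u u₀ r (suc k) m
  B  = u u₀ r (k + suc m)
  Y  = m ! * r ^ m * X
  right≡ : ∏u u₀ r (suc k) (suc m) ≡ M * B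
  right≡ = trans (∏u-snoc u₀ r (suc k) m) (cong (λ i → M * u u₀ r i) (sym (+-suc k m)))
  long≡ : ∏u u₀ r k (suc (suc m)) ≡ uₖ * (M * B)
  long≡ = cong (uₖ *_) right≡
  left∣Y : uₖ * M ∣ Y
  left∣Y = ∏u∣m!*r^m*X u₀ r k m (λ i i≤m → u∣X i (m≤n⇒m≤1+n i≤m))
  right∣Y : M * B ∣ Y
  right∣Y = subst (_∣ Y) right≡ (∏u∣m!*r^m*X u₀ r (suc k) m
    (λ i i≤m → subst (_∣ X) (cong (u u₀ r) (+-suc k i)) (u∣X (suc i) (s≤s i≤m))))
  ∣uₖY+[m+1]rY : uₖ * (M * B) ∣ uₖ * Y + (suc m * r) * Y
  ∣uₖY+[m+1]rY = subst₂ _∣_ (x∙yz≈y∙zx B uₖ M) (B≡ u₀ k m r Y) (*-monoʳ-∣ B left∣Y)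
    where
    B≡ : ∀ u₀ k m r Y → (u₀ + (k + (1 + m)) * r) * Y ≡ (u₀ + k * r) * Y + ((1 + m) * r) * Y
    B≡ = solve-∀
  ∣uₖY : uₖ * (M * B) ∣ uₖ * Y
  ∣uₖY = *-monoʳ-∣ uₖ right∣Y
  target≡ : suc m ! * r ^ suc m * X ≡ (suc m * r) * Y
  target≡ = regroup (m !) (r ^ m) X m r
    where
    regroup : ∀ f p x m r → (1 + m) * f * (r * p) * x ≡ ((1 + m) * r) * (f * p * x)
    regroup = solve-∀

u-coprime : ∀ {u₀ r} i → Coprime u₀ r → Coprime (u u₀ r i) r
u-coprime {u₀} {r} zero    c = subst (λ v → Coprime v r) (sym (+-identityʳ u₀)) c
u-coprime {u₀} {r} (suc i) c = subst (λ v → Coprime v r) (shift r u₀ (i * r)) (coprime-+ (u-coprime i c))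
  where
  shift : ∀ r u x → r + (u + x) ≡ u + (r + x)
  shift = solve-∀

coprime-* : ∀ {a b c} → Coprime a c → Coprime b c → Coprime (a * b) c
coprime-* {a} {b} {c} a⊥c b⊥c {d} (d∣ab , d∣c) = a⊥c (coprime-divisor d⊥b (subst (d ∣_) (*-comm a b) d∣ab) , d∣c)
  where
  d⊥b : Coprime d b
  d⊥b (e∣d , e∣b) = b⊥c (e∣b , ∣-trans e∣d d∣c)

∏u-coprime : ∀ {u₀ r} → Coprime u₀ r → ∀ k m → Coprime (∏u u₀ r k m) r
∏u-coprime c k zero    = 1-coprimeTo _
∏u-coprime c k (suc m) = coprime-* (u-coprime k c) (∏u-coprime c (suc k) m)

coprime-divisor-^ : ∀ {d r y} → Coprime d r → ∀ m → d ∣ r ^ m * y → d ∣ y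
coprime-divisor-^ {d} {y = y} c zero    d∣y = subst (d ∣_) (+-identityʳ y) d∣y
coprime-divisor-^ {d} {r} {y} c (suc m) d∣ry =
  coprime-divisor-^ c m (coprime-divisor c (subst (d ∣_) (*-assoc r (r ^ m) y) d∣ry))

lcm-nonZero : ∀ m n .{{_ : NonZero m}} .{{_ : NonZero n}} → NonZero (lcm m n)
lcm-nonZero m n = ≢-nonZero λ lcm≡0 → ≢-nonZero⁻¹ (m * n) {{m*n≢0 m n}} (begin
  m * n               ≡⟨ gcd*lcm m n ⟨
  gcd m n * lcm m n   ≡⟨ cong (gcd m n *_) lcm≡0 ⟩
  gcd m n * 0         ≡⟨ *-zeroʳ (gcd m n) ⟩
  0                   ∎)
  where open ≡-Reasoning

module _ {u₀ : ℕ} .{{_ : NonZero u₀}} (r : ℕ) where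

  u-nonZero : ∀ i → NonZero (u u₀ r i)
  u-nonZero i = >-nonZero (≤-trans (>-nonZero⁻¹ u₀) (m≤m+n u₀ (i * r)))

  L-nonZero : ∀ n → NonZero (L u₀ r n)
  L-nonZero zero    = u-nonZero 0
  L-nonZero (suc n) = lcm-nonZero _ _ {{L-nonZero n}} {{u-nonZero (suc n)}}

  r^D*∏u≤m!*L : Coprime u₀ r → ∀ k m D → r ^ D ∣ m ! → r ^ D * ∏u u₀ r k (suc m) ≤ m ! * L u₀ r (k + m)
  r^D*∏u≤m!*L c k m D (divides q m!≡q*r^D) = ∣⇒≤ {{m*n≢0 (m !) Λ {{m !≢0}} {{L-nonZero (k + m)}}}}
    (subst (r ^ D * P ∣_) r^D*qΛ≡m!Λ (*-monoʳ-∣ (r ^ D) P∣qΛ))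
    where
    P = ∏u u₀ r k (suc m)
    Λ = L u₀ r (k + m)
    r^D*qΛ≡m!Λ : r ^ D * (q * Λ) ≡ m ! * Λ
    r^D*qΛ≡m!Λ = trans (sym (*-assoc (r ^ D) q Λ)) (cong (_* Λ) (trans (*-comm (r ^ D) q) (sym m!≡q*r^D)))
    P∣m!Λ : P ∣ m ! * Λ
    P∣m!Λ = coprime-divisor-^ (∏u-coprime c k (suc m)) m (subst (P ∣_) (xy∙z≈y∙xz (m !) (r ^ m) Λ)
      (∏u∣m!*r^m*X u₀ r k m (λ i i≤m → u∣L u₀ r (+-monoʳ-≤ k i≤m))))
    P∣qΛ : P ∣ q * Λ
    P∣qΛ = coprime-divisor-^ (∏u-coprime c k (suc m)) D (subst (P ∣_) (sym r^D*qΛ≡m!Λ) P∣m!Λ)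

triangular : ℕ → ℕ
triangular zero    = 0
triangular (suc m) = triangular m + m

2*triangular[1+m]≡m*[1+m] : ∀ m → 2 * triangular (suc m) ≡ m * suc m
2*triangular[1+m]≡m*[1+m] zero    = refl
2*triangular[1+m]≡m*[1+m] (suc m) = begin
  2 * (triangular (suc m) + suc m)   ≡⟨ *-distribˡ-+ 2 (triangular (suc m)) (suc m) ⟩
  2 * triangular (suc m) + 2 * suc m ≡⟨ cong (_+ 2 * suc m) (2*triangular[1+m]≡m*[1+m] m) ⟩
  m * suc m + 2 * suc m              ≡⟨ collect m ⟩
  suc m * suc (suc m)                ∎
  where
  open ≡-Reasoning
  collect : ∀ m → m * (1 + m) + 2 * (1 + m) ≡ (1 + m) * (2 + m)
  collect = solve-∀

2xy≤x²+y² : ∀ x y → 2 * (x * y) ≤ x * x + y * y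
2xy≤x²+y² x y = [ ordered , (λ y≤x → subst₂ _≤_ (cong (2 *_) (*-comm y x)) (+-comm (y * y) (x * x)) (ordered y≤x)) ]′
  (≤-total x y)
  where
  ordered : ∀ {x y} → x ≤ y → 2 * (x * y) ≤ x * x + y * y
  ordered {x} x≤y with m≤n⇒∃[o]m+o≡n x≤y
  ... | d , refl = subst (2 * (x * (x + d)) ≤_) (square x d) (m≤m+n _ (d * d))
    where
    square : ∀ x d → 2 * (x * (x + d)) + d * d ≡ x * x + (x + d) * (x + d)
    square = solve-∀

mxy≤xy+x²+triangular[m]y² : ∀ m x y → m * x * y ≤ x * y + x * x + triangular m * (y * y)
mxy≤xy+x²+triangular[m]y² zero    x y = z≤n
mxy≤xy+x²+triangular[m]y² (suc m) x y = begin
  suc m * x * y                                     ≡⟨ peel m x y ⟩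
  x * y + m * x * y                                 ≤⟨ +-monoʳ-≤ (x * y) (*-cancelˡ-≤ 4 quadrupled) ⟩
  x * y + (x * x + triangular (suc m) * (y * y))    ≡⟨ +-assoc (x * y) (x * x) _ ⟨
  x * y + x * x + triangular (suc m) * (y * y)      ∎
  where
  open ≤-Reasoning
  t = triangular (suc m)
  peel : ∀ m x y → (1 + m) * x * y ≡ x * y + m * x * y
  peel = solve-∀
  quadrupled : 4 * (m * x * y) ≤ 4 * (x * x + t * (y * y))
  quadrupled = begin
    4 * (m * x * y)                       ≡⟨ regroup₁ m x y ⟩
    2 * ((2 * x) * (m * y))               ≤⟨ 2xy≤x²+y² (2 * x) (m * y) ⟩
    (2 * x) * (2 * x) + (m * y) * (m * y) ≤⟨ +-monoʳ-≤ ((2 * x) * (2 * x)) (≤-reflexive (regroup₂ m y)) ⟩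
    (2 * x) * (2 * x) + (m * m) * (y * y) ≤⟨ +-monoʳ-≤ ((2 * x) * (2 * x)) (*-monoˡ-≤ (y * y) (*-monoʳ-≤ m (n≤1+n m))) ⟩
    (2 * x) * (2 * x) + (m * suc m) * (y * y) ≡⟨ cong (λ s → (2 * x) * (2 * x) + s * (y * y)) (2*triangular[1+m]≡m*[1+m] m) ⟨
    (2 * x) * (2 * x) + (2 * t) * (y * y) ≤⟨ m≤m+n _ ((2 * t) * (y * y)) ⟩
    (2 * x) * (2 * x) + (2 * t) * (y * y) + (2 * t) * (y * y) ≡⟨ regroup₃ x t y ⟩
    4 * (x * x + t * (y * y))             ∎
    where
    regroup₁ : ∀ m x y → 4 * (m * x * y) ≡ 2 * ((2 * x) * (m * y))
    regroup₁ = solve-∀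
    regroup₂ : ∀ m y → (m * y) * (m * y) ≡ (m * m) * (y * y)
    regroup₂ = solve-∀
    regroup₃ : ∀ x t y → (2 * x) * (2 * x) + (2 * t) * (y * y) + (2 * t) * (y * y) ≡ 4 * (x * x + t * (y * y))
    regroup₃ = solve-∀

-- N² times the terms of degree at most 2 of (1 + u₀ / N) ^ m.
binomialHead : ℕ → ℕ → ℕ → ℕ
binomialHead u₀ N m = N * N + m * N * u₀ + triangular m * (u₀ * u₀)

binomialHead-step : ∀ u₀ N m {a} → a ≤ N → a * binomialHead u₀ N (suc m) ≤ (u₀ + a) * binomialHead u₀ N m
binomialHead-step u₀ N m {a} a≤N = begin
  a * binomialHead u₀ N (suc m)
    ≡⟨ expand a N u₀ m t ⟩
  a * X + (a * (N * u₀) + a * (m * (u₀ * u₀)))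
    ≤⟨ +-monoʳ-≤ (a * X) (+-mono-≤ (*-monoˡ-≤ (N * u₀) a≤N) (*-monoˡ-≤ (m * (u₀ * u₀)) a≤N)) ⟩
  a * X + (N * (N * u₀) + N * (m * (u₀ * u₀)))
    ≤⟨ +-monoʳ-≤ (a * X) (m≤m+n _ (u₀ * (t * (u₀ * u₀)))) ⟩
  a * X + (N * (N * u₀) + N * (m * (u₀ * u₀)) + u₀ * (t * (u₀ * u₀)))
    ≡⟨ collect a N u₀ m t ⟩
  (u₀ + a) * X
    ∎
  where
  open ≤-Reasoning
  t = triangular m
  X = binomialHead u₀ N m
  expand : ∀ a N u₀ m t → a * (N * N + (1 + m) * N * u₀ + (t + m) * (u₀ * u₀))
    ≡ a * (N * N + m * N * u₀ + t * (u₀ * u₀)) + (a * (N * u₀) + a * (m * (u₀ * u₀)))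
  expand = solve-∀
  collect : ∀ a N u₀ m t →
    a * (N * N + m * N * u₀ + t * (u₀ * u₀)) + (N * (N * u₀) + N * (m * (u₀ * u₀)) + u₀ * (t * (u₀ * u₀)))
      ≡ (u₀ + a) * (N * N + m * N * u₀ + t * (u₀ * u₀))
  collect = solve-∀

∏u[0]*binomialHead≤N²*∏u : ∀ u₀ r n m k → k + m ≤ n →
  ∏u 0 r (suc k) m * binomialHead u₀ (n * r) m ≤ (n * r) * (n * r) * ∏u u₀ r (suc k) m
∏u[0]*binomialHead≤N²*∏u u₀ r n zero    k _ = ≤-reflexive (trivial (n * r) u₀)
  where
  trivial : ∀ N u₀ → 1 * (N * N + 0 * N * u₀ + 0 * (u₀ * u₀)) ≡ N * N * 1
  trivial = solve-∀
∏u[0]*binomialHead≤N²*∏u u₀ r n (suc m) k k+m<n = begin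
  a * P * binomialHead u₀ N (suc m)
    ≡⟨ xy∙z≈y∙xz a P _ ⟩
  P * (a * binomialHead u₀ N (suc m))
    ≤⟨ *-monoʳ-≤ P (binomialHead-step u₀ N m a≤N) ⟩
  P * ((u₀ + a) * binomialHead u₀ N m)
    ≡⟨ x∙yz≈y∙xz P (u₀ + a) _ ⟩
  (u₀ + a) * (P * binomialHead u₀ N m)
    ≤⟨ *-monoʳ-≤ (u₀ + a) (∏u[0]*binomialHead≤N²*∏u u₀ r n m (suc k) 1+k+m≤n) ⟩
  (u₀ + a) * (N * N * ∏u u₀ r (suc (suc k)) m)
    ≡⟨ x∙yz≈y∙xz (u₀ + a) (N * N) _ ⟩
  N * N * ((u₀ + a) * ∏u u₀ r (suc (suc k)) m)
    ∎
  where
  open ≤-Reasoning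
  N = n * r
  a = suc k * r
  P = ∏u 0 r (suc (suc k)) m
  1+k+m≤n : suc k + m ≤ n
  1+k+m≤n = subst (_≤ n) (+-suc k m) k+m<n
  a≤N : a ≤ N
  a≤N = *-monoˡ-≤ r (m+n≤o⇒m≤o (suc k) 1+k+m≤n)

binomialHead-bound : ∀ u₀ r k m →
  u₀ * ((k + m) * r) * r * (m + 2 * k * m) ≤ (u₀ + k * r) * binomialHead u₀ ((k + m) * r) m
binomialHead-bound u₀ r k m = begin
  u₀ * N * r * (m + 2 * k * m)
    ≡⟨ expand u₀ r k m N ⟩
  u₀ * N * (r * m) + k * r * (m * N * u₀) + k * r * (m * N * u₀)
    ≤⟨ +-monoʳ-≤ _ (*-monoʳ-≤ (k * r) (mxy≤xy+x²+triangular[m]y² m N u₀)) ⟩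
  u₀ * N * (r * m) + k * r * (m * N * u₀) + k * r * (N * u₀ + N * N + t * (u₀ * u₀))
    ≤⟨ m≤m+n _ (u₀ * (m * N * u₀ + t * (u₀ * u₀))) ⟩
  u₀ * N * (r * m) + k * r * (m * N * u₀) + k * r * (N * u₀ + N * N + t * (u₀ * u₀)) + u₀ * (m * N * u₀ + t * (u₀ * u₀))
    ≡⟨ collect u₀ r k m t ⟩
  (u₀ + k * r) * binomialHead u₀ N m
    ∎
  where
  open ≤-Reasoning
  N = (k + m) * r
  t = triangular m
  expand : ∀ u₀ r k m N →
    u₀ * N * r * (m + 2 * k * m) ≡ u₀ * N * (r * m) + k * r * (m * N * u₀) + k * r * (m * N * u₀)
  expand = solve-∀
  collect : ∀ u₀ r k m t → let N = (k + m) * r in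
    u₀ * N * (r * m) + k * r * (m * N * u₀) + k * r * (N * u₀ + N * N + t * (u₀ * u₀)) + u₀ * (m * N * u₀ + t * (u₀ * u₀))
      ≡ (u₀ + k * r) * (N * N + m * N * u₀ + t * (u₀ * u₀))
  collect = solve-∀

∏u-lower-bound : ∀ u₀ r k m .{{_ : NonZero r}} .{{_ : NonZero (k + m)}} →
  u₀ * ∏u 0 r (suc k) m * (m + 2 * k * m) ≤ (k + m) * ∏u u₀ r k (suc m)
∏u-lower-bound u₀ r k m = *-cancelˡ-≤ (N * r) {{m*n≢0 N r {{m*n≢0 n r}}}} (begin
  N * r * (u₀ * P * W)             ≡⟨ regroup₁ N r u₀ P W ⟩
  P * (u₀ * N * r * W)             ≤⟨ *-monoʳ-≤ P (binomialHead-bound u₀ r k m) ⟩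
  P * ((u₀ + k * r) * X)           ≡⟨ x∙yz≈y∙xz P (u₀ + k * r) X ⟩
  (u₀ + k * r) * (P * X)           ≤⟨ *-monoʳ-≤ (u₀ + k * r) (∏u[0]*binomialHead≤N²*∏u u₀ r n m k ≤-refl) ⟩
  (u₀ + k * r) * (N * N * Q)       ≡⟨ regroup₂ (u₀ + k * r) n r Q ⟩
  N * r * (n * ((u₀ + k * r) * Q)) ∎)
  where
  open ≤-Reasoning
  n = k + m
  N = n * r
  P = ∏u 0 r (suc k) m
  Q = ∏u u₀ r (suc k) m
  W = m + 2 * k * m
  X = binomialHead u₀ N m
  regroup₁ : ∀ N r u₀ P W → N * r * (u₀ * P * W) ≡ P * (u₀ * N * r * W)
  regroup₁ = solve-∀
  regroup₂ : ∀ w n r Q → w * (n * r * (n * r) * Q) ≡ n * r * r * (n * (w * Q))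
  regroup₂ = solve-∀

r^j*j!∣[j*r]! : ∀ r .{{_ : NonZero r}} j → r ^ j * j ! ∣ (j * r) !
r^j*j!∣[j*r]! r         zero    = ∣-refl
r^j*j!∣[j*r]! r@(suc s) (suc j) = subst (_∣ (suc j * r) !) (regroup (r ^ j) (j !) j r)
  (∣-trans (*-monoˡ-∣ (suc j * r) (r^j*j!∣[j*r]! r j)) [j*r]!*[j*r+r]∣[j*r+r]!)
  where
  regroup : ∀ p f j r → p * f * ((1 + j) * r) ≡ r * p * ((1 + j) * f)
  regroup = solve-∀
  [j*r]!*[j*r+r]∣[j*r+r]! : (j * r) ! * suc (s + j * r) ∣ suc (s + j * r) !
  [j*r]!*[j*r+r]∣[j*r+r]! = subst ((j * r) ! * suc (s + j * r) ∣_) (*-comm ((s + j * r) !) (suc (s + j * r)))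
    (*-monoˡ-∣ (suc (s + j * r)) (m≤n⇒m!∣n! (m≤n+m (j * r) s)))

r^j∣m! : ∀ r .{{_ : NonZero r}} {j m} → j * r ≤ m → r ^ j ∣ m !
r^j∣m! r {j} jr≤m = ∣-trans (∣-trans (m∣m*n (j !)) (r^j*j!∣[j*r]! r j)) (m≤n⇒m!∣n! jr≤m)

r^[j+i]∣m! : ∀ r .{{_ : NonZero r}} {j i m} → j * r ≤ m → i * r ≤ j → r ^ (j + i) ∣ m !
r^[j+i]∣m! r {j} {i} {m} jr≤m ir≤j = subst (_∣ m !) (sym (^-distribˡ-+-* r j i))
  (∣-trans (*-monoʳ-∣ (r ^ j) (r^j∣m! r {i} ir≤j)) (∣-trans (r^j*j!∣[j*r]! r j) (m≤n⇒m!∣n! jr≤m)))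

^-monoʳ-∣ : ∀ r {i j} → i ≤ j → r ^ i ∣ r ^ j
^-monoʳ-∣ r {i} i≤j with m≤n⇒∃[o]m+o≡n i≤j
... | d , refl = subst (r ^ i ∣_) (sym (^-distribˡ-+-* r i d)) (m∣m*n (r ^ d))

module _ {u₀ r : ℕ} .{{_ : NonZero u₀}} .{{_ : NonZero r}} (u₀⊥r : Coprime u₀ r) where

  r^D*u₀*binomialTerm*W≤n*L : ∀ k m D .{{_ : NonZero (k + m)}} → r ^ D ∣ m ! →
    r ^ D * (u₀ * binomialTerm r (k + m) k * (m + 2 * k * m)) ≤ (k + m) * L u₀ r (k + m)
  r^D*u₀*binomialTerm*W≤n*L k m D r^D∣m! = *-cancelˡ-≤ (m !) {{m !≢0}} (begin
    m ! * (r ^ D * (u₀ * T * W))         ≡⟨ regroup (m !) (r ^ D) u₀ T W ⟩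
    r ^ D * (u₀ * (m ! * T) * W)         ≡⟨ cong (λ p → r ^ D * (u₀ * p * W)) (∏u[0]≡m!*binomialTerm r k m) ⟨
    r ^ D * (u₀ * ∏u 0 r (suc k) m * W)  ≤⟨ *-monoʳ-≤ (r ^ D) (∏u-lower-bound u₀ r k m) ⟩
    r ^ D * ((k + m) * ∏u u₀ r k (suc m)) ≡⟨ x∙yz≈y∙xz (r ^ D) (k + m) _ ⟩
    (k + m) * (r ^ D * ∏u u₀ r k (suc m)) ≤⟨ *-monoʳ-≤ (k + m) (r^D*∏u≤m!*L r u₀⊥r k m D r^D∣m!) ⟩
    (k + m) * (m ! * L u₀ r (k + m))     ≡⟨ x∙yz≈y∙xz (k + m) (m !) _ ⟩
    m ! * ((k + m) * L u₀ r (k + m))     ∎)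
    where
    open ≤-Reasoning
    T = binomialTerm r (k + m) k
    W = m + 2 * k * m
    regroup : ∀ f p u T W → f * (p * (u * T * W)) ≡ p * (u * (f * T) * W)
    regroup = solve-∀

  lcm-bound : ∀ e d k m .{{_ : NonZero (k + m)}} → r ^ (e + d) ∣ m ! →
    (r + 1) ^ (k + m) ≤ suc (k + m) * binomialTerm r (k + m) k →
    (k + m) * suc (k + m) ≤ r ^ d * (m + 2 * k * m) →
    u₀ * r ^ e * (r + 1) ^ (k + m) ≤ L u₀ r (k + m)
  lcm-bound e d k m r^[e+d]∣m! near-mode quadratic = *-cancelˡ-≤ (n * suc n) {{m*n≢0 n (suc n)}} (begin
    n * suc n * (u₀ * r ^ e * R)              ≡⟨ regroup₁ (n * suc n) u₀ (r ^ e) R ⟩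
    u₀ * (r ^ e * (n * suc n)) * R            ≤⟨ *-mono-≤ (*-monoʳ-≤ u₀ (*-monoʳ-≤ (r ^ e) quadratic)) near-mode ⟩
    u₀ * (r ^ e * (r ^ d * W)) * (suc n * T)  ≡⟨ regroup₂ u₀ (r ^ e) (r ^ d) W (suc n) T ⟩
    suc n * (r ^ e * r ^ d * (u₀ * T * W))    ≡⟨ cong (λ p → suc n * (p * (u₀ * T * W))) (^-distribˡ-+-* r e d) ⟨
    suc n * (r ^ (e + d) * (u₀ * T * W))      ≤⟨ *-monoʳ-≤ (suc n) (r^D*u₀*binomialTerm*W≤n*L k m (e + d) r^[e+d]∣m!) ⟩
    suc n * (n * L u₀ r n)                    ≡⟨ x∙yz≈yx∙z (suc n) n (L u₀ r n) ⟩
    n * suc n * L u₀ r n                      ∎)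
    where
    open ≤-Reasoning
    n = k + m
    R = (r + 1) ^ n
    T = binomialTerm r n k
    W = m + 2 * k * m
    regroup₁ : ∀ a u p R → a * (u * p * R) ≡ u * (p * a) * R
    regroup₁ = solve-∀
    regroup₂ : ∀ u p q W s T → u * (p * (q * W)) * (s * T) ≡ s * (p * q * (u * T * W))
    regroup₂ = solve-∀

balanced-1≤k : ∀ {r k m} → Balanced r k m → r ≤ k + m → 1 ≤ k
balanced-1≤k {k = suc _} _ _ = s≤s z≤n
balanced-1≤k {r} {zero} {m} (balanced _ m<r) r≤m = contradiction r≤m (<⇒≱ (subst (m <_) (+-identityʳ r) m<r))

module _ {r k m : ℕ} (bal : Balanced r k m) where

  open Balanced bal renaming (lower to kr≤m+1; upper to m<[k+1]r)

  j*r≤m : .{{_ : NonZero r}} → ∀ {j} → j * (r + 1) ≤ k + m → j * r ≤ m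
  j*r≤m {j} j[r+1]≤n with j * r ≤? m
  ... | yes jr≤m = jr≤m
  ... | no  jr≰m = contradiction j[r+1]≤n (<⇒≱ (begin-strict
    k + m        <⟨ +-monoʳ-< k (n<1+n m) ⟩
    k + suc m    ≤⟨ +-mono-≤ k≤j m<jr ⟩
    j + j * r    ≡⟨ j+jr≡j[r+1] j r ⟩
    j * (r + 1)  ∎))
    where
    open ≤-Reasoning
    m<jr = ≰⇒> jr≰m
    k≤j = *-cancelʳ-≤ k j r (≤-trans kr≤m+1 m<jr)
    j+jr≡j[r+1] : ∀ j r → j + j * r ≡ j * (r + 1)
    j+jr≡j[r+1] = solve-∀

  balanced-quadratic : ∀ ρ → r ≤ ρ → k + 1 + 2 * m + r * m ≤ 2 * ρ * m →
    (k + m) * suc (k + m) ≤ ρ * (m + 2 * k * m)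
  balanced-quadratic ρ r≤ρ linear = begin
    (k + m) * suc (k + m)                        ≡⟨ expand k m ⟩
    k * suc k + 2 * k * m + m * suc m            ≤⟨ +-monoʳ-≤ (k * suc k + 2 * k * m) (*-monoʳ-≤ m m<[k+1]r) ⟩
    k * suc k + 2 * k * m + m * (suc k * r)      ≡⟨ regroup k m r ⟩
    k * (k + 1 + 2 * m + r * m) + r * m          ≤⟨ +-mono-≤ (*-monoʳ-≤ k linear) (*-monoˡ-≤ m r≤ρ) ⟩
    k * (2 * ρ * m) + ρ * m                      ≡⟨ collect k m ρ ⟩
    ρ * (m + 2 * k * m)                          ∎
    where
    open ≤-Reasoning
    expand : ∀ k m → (k + m) * (1 + (k + m)) ≡ k * (1 + k) + 2 * k * m + m * (1 + m)
    expand = solve-∀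
    regroup : ∀ k m r → k * (1 + k) + 2 * k * m + m * ((1 + k) * r) ≡ k * (k + 1 + 2 * m + r * m) + r * m
    regroup = solve-∀
    collect : ∀ k m ρ → k * (2 * ρ * m) + ρ * m ≡ ρ * (m + 2 * k * m)
    collect = solve-∀

  balanced-quadratic-3≤r : 1 ≤ k → 3 ≤ r → (k + m) * suc (k + m) ≤ r ^ 1 * (m + 2 * k * m)
  balanced-quadratic-3≤r 1≤k 3≤r = subst (λ ρ → (k + m) * suc (k + m) ≤ ρ * (m + 2 * k * m)) (sym (*-identityʳ r))
    (balanced-quadratic r ≤-refl (begin
      k + 1 + 2 * m + r * m   ≤⟨ +-monoˡ-≤ (r * m) (+-monoˡ-≤ (2 * m) k+1≤m) ⟩
      m + 2 * m + r * m       ≡⟨ cong (_+ r * m) (m+2m≡3m m) ⟩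
      3 * m + r * m           ≤⟨ +-monoˡ-≤ (r * m) (*-monoˡ-≤ m 3≤r) ⟩
      r * m + r * m           ≡⟨ rm+rm≡2rm r m ⟩
      2 * r * m               ∎))
    where
    open ≤-Reasoning
    m+2m≡3m : ∀ m → m + 2 * m ≡ 3 * m
    m+2m≡3m = solve-∀
    rm+rm≡2rm : ∀ r m → r * m + r * m ≡ 2 * r * m
    rm+rm≡2rm = solve-∀
    k+2k≡k*3 : ∀ k → k + 2 * k ≡ k * 3
    k+2k≡k*3 = solve-∀
    k+1≤m : k + 1 ≤ m
    k+1≤m = s≤s⁻¹ (begin
      suc (k + 1)  ≡⟨ +-suc k 1 ⟨
      k + 2        ≤⟨ +-monoʳ-≤ k (*-monoʳ-≤ 2 1≤k) ⟩
      k + 2 * k    ≡⟨ k+2k≡k*3 k ⟩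
      k * 3        ≤⟨ *-monoʳ-≤ k 3≤r ⟩
      k * r        ≤⟨ kr≤m+1 ⟩
      suc m        ∎)

balanced-quadratic-r≡2 : ∀ {k m} → Balanced 2 k m → 1 ≤ k → (k + m) * suc (k + m) ≤ 2 ^ 2 * (m + 2 * k * m)
balanced-quadratic-r≡2 {k} {m} bal@(balanced 2k≤m+1 _) 1≤k = balanced-quadratic bal 4 (s≤s (s≤s z≤n)) (begin
  k + 1 + 2 * m + 2 * m   ≤⟨ +-monoˡ-≤ (2 * m) (+-monoˡ-≤ (2 * m) k+1≤2m) ⟩
  2 * m + 2 * m + 2 * m   ≡⟨ six m ⟩
  6 * m                   ≤⟨ *-monoˡ-≤ m (≤ᵇ⇒≤ 6 8 tt) ⟩
  2 * 4 * m               ∎)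
  where
  open ≤-Reasoning
  six : ∀ m → 2 * m + 2 * m + 2 * m ≡ 6 * m
  six = solve-∀
  k≤m : k ≤ m
  k≤m = s≤s⁻¹ (begin
    suc k   ≡⟨ +-comm 1 k ⟩
    k + 1   ≤⟨ +-monoʳ-≤ k 1≤k ⟩
    k + k   ≡⟨ k+k≡k*2 k ⟩
    k * 2   ≤⟨ 2k≤m+1 ⟩
    suc m   ∎)
    where
    k+k≡k*2 : ∀ k → k + k ≡ k * 2
    k+k≡k*2 = solve-∀
  k+1≤2m : k + 1 ≤ 2 * m
  k+1≤2m = ≤-trans (+-mono-≤ k≤m (≤-trans 1≤k k≤m)) (≤-reflexive (cong (m +_) (sym (+-identityʳ m))))

module _ {u₀ r : ℕ} .{{_ : NonZero u₀}} .{{_ : NonZero r}} (u₀⊥r : Coprime u₀ r) where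

  L-bound-via-exponents : ∀ e d n j i → r ≤ n → j * (r + 1) ≤ n → i * r ≤ j → e + d ≤ j + i →
    (∀ {k m} → Balanced r k m → 1 ≤ k → (k + m) * suc (k + m) ≤ r ^ d * (m + 2 * k * m)) →
    u₀ * r ^ e * (r + 1) ^ n ≤ L u₀ r n
  L-bound-via-exponents e d n j i r≤n j[r+1]≤n ir≤j e+d≤j+i quadratic with balanced-split r n
  ... | k , m , refl , bal =
    lcm-bound u₀⊥r e d k m {{k+m≢0}} r^[e+d]∣m! (binomial-≤-mode bal) (quadratic bal 1≤k)
    where
    1≤k = balanced-1≤k bal r≤n
    k+m≢0 = >-nonZero (≤-trans 1≤k (m≤m+n k m))
    r^[e+d]∣m! = ∣-trans (^-monoʳ-∣ r e+d≤j+i) (r^[j+i]∣m! r (j*r≤m bal {j} j[r+1]≤n) ir≤j)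

j*[r+1]≤2αr : ∀ {j s} α r → j + s ≡ 2 * α → j ≤ s * r → j * (r + 1) ≤ 2 * α * r
j*[r+1]≤2αr {j} {s} α r j+s≡2α j≤sr = begin
  j * (r + 1)     ≡⟨ split j r ⟩
  j * r + j       ≤⟨ +-monoʳ-≤ (j * r) j≤sr ⟩
  j * r + s * r   ≡⟨ *-distribʳ-+ r j s ⟨
  (j + s) * r     ≡⟨ cong (_* r) j+s≡2α ⟩
  2 * α * r       ∎
  where
  open ≤-Reasoning
  split : ∀ j r → j * (r + 1) ≡ j * r + j
  split = solve-∀

module _ {u₀ : ℕ} .{{_ : NonZero u₀}} where

  L-lower-bound-3≤r : ∀ {r} → Coprime u₀ r → 3 ≤ r → ∀ b α n → 2 + b ≤ α → 2 + b ≤ r → 2 * α * r ≤ n →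
    u₀ * r ^ (α + b) * (r + 1) ^ n ≤ L u₀ r n
  L-lower-bound-3≤r {r@(suc _)} u₀⊥r 3≤r b α n a≤α a≤r 2αr≤n with m≤n⇒∃[o]m+o≡n a≤α
  ... | p , refl with r ≤? α + b
  ...   | yes r≤α+b = L-bound-via-exponents u₀⊥r (α + b) 1 n (α + b) 1 (≤-trans (m≤n*m r (2 * α)) 2αr≤n)
    (≤-trans (j*[r+1]≤2αr α r (halves b p) α+b≤[2+p]r) 2αr≤n) (subst (_≤ α + b) (sym (*-identityˡ r)) r≤α+b) ≤-refl
    (λ bal 1≤k → balanced-quadratic-3≤r bal 1≤k 3≤r)
    where
    halves : ∀ b p → (2 + b + p) + b + (2 + p) ≡ 2 * (2 + b + p)
    halves = solve-∀
    α+b≤[2+p]r : α + b ≤ (2 + p) * r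
    α+b≤[2+p]r = begin
      α + b               ≤⟨ m≤m+n (α + b) (2 + p + p * b) ⟩
      α + b + (2 + p + p * b) ≡⟨ expand b p ⟩
      (2 + p) * (2 + b)   ≤⟨ *-monoʳ-≤ (2 + p) a≤r ⟩
      (2 + p) * r         ∎
      where
      open ≤-Reasoning
      expand : ∀ b p → (2 + b + p) + b + (2 + p + p * b) ≡ (2 + p) * (2 + b)
      expand = solve-∀
  ...   | no  r≰α+b = L-bound-via-exponents u₀⊥r (α + b) 1 n (suc (α + b)) 0 (≤-trans (m≤n*m r (2 * α)) 2αr≤n)
    (≤-trans (j*[r+1]≤2αr α r (halves b p) (≤-trans (≰⇒> r≰α+b) (m≤m+n r (p * r)))) 2αr≤n) z≤n
    (≤-reflexive (trans (+-comm (α + b) 1) (sym (+-identityʳ _))))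
    (λ bal 1≤k → balanced-quadratic-3≤r bal 1≤k 3≤r)
    where
    halves : ∀ b p → suc (2 + b + p + b) + (1 + p) ≡ 2 * (2 + b + p)
    halves = solve-∀

  -- For n = 8 the mode k = 3 leaves only 2 ^ 3 ∣ 5 !, so the split 8 = 2 + 6 is used instead.
  L-lower-bound-r≡2-n≡8 : Coprime u₀ 2 → u₀ * 2 ^ (2 + 0) * (2 + 1) ^ 8 ≤ L u₀ 2 8
  L-lower-bound-r≡2-n≡8 u₀⊥2 = lcm-bound u₀⊥2 2 2 2 6 (divides 45 refl) (≤ᵇ⇒≤ _ _ tt) (≤ᵇ⇒≤ _ _ tt)

  L-lower-bound-r≡2 : Coprime u₀ 2 → ∀ α n → 2 ≤ α → 2 * α * 2 ≤ n → u₀ * 2 ^ (α + 0) * (2 + 1) ^ n ≤ L u₀ 2 n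
  L-lower-bound-r≡2 u₀⊥2 α@(suc (suc (suc p))) n _ 4α≤n =
    L-bound-via-exponents u₀⊥2 (α + 0) 2 n (suc α) 1 (≤-trans (m≤n*m 2 (2 * α)) 4α≤n)
      (≤-trans (j*[r+1]≤2αr α 2 (halves p) (4+p≤[2+p]2 p)) 4α≤n) (s≤s (s≤s z≤n)) (≤-reflexive (shift α))
      balanced-quadratic-r≡2
    where
    halves : ∀ p → 4 + p + (2 + p) ≡ 2 * (3 + p)
    halves = solve-∀
    4+p≤[2+p]2 : ∀ p → 4 + p ≤ (2 + p) * 2
    4+p≤[2+p]2 p = subst (4 + p ≤_) (double p) (m≤m+n (4 + p) p)
      where
      double : ∀ p → 4 + p + p ≡ (2 + p) * 2
      double = solve-∀
    shift : ∀ α → α + 0 + 2 ≡ suc α + 1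
    shift = solve-∀
  L-lower-bound-r≡2 u₀⊥2 2 n _ 8≤n with 9 ≤? n
  ... | yes 9≤n = L-bound-via-exponents u₀⊥2 2 2 n 3 1 (≤-trans (≤ᵇ⇒≤ 2 9 tt) 9≤n) 9≤n (s≤s (s≤s z≤n)) ≤-refl
    balanced-quadratic-r≡2
  ... | no  9≰n rewrite ≤-antisym (s≤s⁻¹ (≰⇒> 9≰n)) 8≤n = L-lower-bound-r≡2-n≡8 u₀⊥2
  L-lower-bound-r≡2 u₀⊥2 1 n (s≤s ()) _

  L-lower-bound : ∀ r b α n → Coprime u₀ r → 2 + b ≤ α → 2 + b ≤ r → 2 * α * r ≤ n →
    u₀ * r ^ (α + b) * (r + 1) ^ n ≤ L u₀ r n
  L-lower-bound 1 b α n _ _ (s≤s ()) _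
  L-lower-bound 2 zero α n u₀⊥2 2≤α _ 4α≤n = L-lower-bound-r≡2 u₀⊥2 α n 2≤α 4α≤n
  L-lower-bound 2 (suc b) α n _ _ (s≤s (s≤s ())) _
  L-lower-bound r@(suc (suc (suc _))) b α n u₀⊥r a≤α a≤r 2αr≤n =
    L-lower-bound-3≤r u₀⊥r (s≤s (s≤s (s≤s z≤n))) b α n a≤α a≤r 2αr≤n

theorem1p2 : (u₀ r a α n : ℕ) → 1 ≤ u₀ → 1 ≤ r → gcd u₀ r ≡ 1 →
    2 ≤ a → α ≥ a → r ≥ a → n ≥ 2 * α * r →
    L u₀ r n ≥ u₀ * r ^ (α + a ∸ 2) * (r + 1) ^ n
theorem1p2 u₀ r a α n 1≤u₀ _ gcd≡1 2≤a a≤α a≤r 2αr≤n with m≤n⇒∃[o]m+o≡n 2≤a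
... | b , refl rewrite +-∸-assoc α 2≤a =
  L-lower-bound {{>-nonZero 1≤u₀}} r b α n (gcd≡1⇒coprime gcd≡1) a≤α a≤r 2αr≤n
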